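{- In the calculus $\mathbf{C}_{\mathbf{IK}}$ the following rules are admissible (whenever the premise is provable, so is the conclusion), for every context $G\{\ \}$, multisets $\Gamma,\Delta$, formula $A$, and $\mathcal O$ either a formula or a block: $(w_R)$: from $G\{\Gamma\Rightarrow\Delta\}$ infer $G\{\Gamma\Rightarrow\Delta,\mathcal O\}$; $(w_L)$: from $G\{\Gamma\Rightarrow\Delta\}$ infer $G\{A,\Gamma\Rightarrow\Delta\}$; $(w_C)$: from $\Gamma\Rightarrow\Delta$ infer $G\{\Gamma\Rightarrow\Delta\}$; $(c_R)$: from $G\{\Gamma\Rightarrow\Delta,\mathcal O,\mathcal O\}$ infer $G\{\Gamma\Rightarrow\Delta,\mathcal O\}$; $(c_L)$: from $G\{\Gamma,A,A\Rightarrow\Delta\}$ infer $G\{\Gamma,A\Rightarrow\Delta\}$; $(\langle\emptyset\rangle)$: from $G\{\Gamma\Rightarrow\Delta,\langle\ \Rightarrow\ \rangle\}$ infer $G\{\Gamma\Rightarrow\Delta\}$.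
   Context: Formulas: $A ::= p \mid \bot \mid \top \mid A\wedge A\mid A\vee A\mid A\supset A\mid \Box A\mid \Diamond A$, $p$ atomic. Bi-nested sequents: $\Rightarrow$ is one; if $\Gamma,\Delta'$ are finite multisets of formulas and $S_i,T_j$ bi-nested sequents, $\Gamma\Rightarrow\Delta',\langle S_1\rangle,\dots,\langle S_m\rangle,[T_1],\dots,[T_n]$ is one ($\langle\cdot\rangle$ implication blocks, $[\cdot]$ modal blocks; a block is $\langle S\rangle$ or $[S]$). Contexts: $\{\ \}$ is a context; if $\Gamma\Rightarrow\Delta$ is a sequent and $G'\{\ \}$ a context then $\Gamma\Rightarrow\Delta,\langle G'\{\ \}\rangle$ and $\Gamma\Rightarrow\Delta,[G'\{\ \}]$ are contexts; $G\{S\}$ fills the hole with sequent $S$. Local positive part: if $\Delta=\Delta_0,[\Lambda_1\Rightarrow\Theta_1],\dots,[\Lambda_k\Rightarrow\Theta_k]$ with $\Delta_0$ free of modal blocks, $\Delta^*=[\Lambda_1\Rightarrow\Theta_1^*],\dots,[\Lambda_k\Rightarrow\Theta_k^*]$. Rules of $\mathbf{C}_{\mathbf{IK}}$ (premises / conclusion): axioms $G\{\Gamma,\bot\Rightarrow\Delta\}$, $G\{\Gamma\Rightarrow\top,\Delta\}$, $G\{\Gamma,p\Rightarrow\Delta,p\}$; $(\wedge_L)$ $G\{A,B,\Gamma\Rightarrow\Delta\}$ / $G\{A\wedge B,\Gamma\Rightarrow\Delta\}$; $(\wedge_R)$ $G\{\Gamma\Rightarrow\Delta,A\}$ and $G\{\Gamma\Rightarrow\Delta,B\}$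 / $G\{\Gamma\Rightarrow\Delta,A\wedge B\}$; $(\vee_L)$ $G\{\Gamma,A\Rightarrow\Delta\}$ and $G\{\Gamma,B\Rightarrow\Delta\}$ / $G\{\Gamma,A\vee B\Rightarrow\Delta\}$; $(\vee_R)$ $G\{\Gamma\Rightarrow\Delta,A,B\}$ / $G\{\Gamma\Rightarrow\Delta,A\vee B\}$; $(\supset_L)$ $G\{\Gamma,A\supset B\Rightarrow A,\Delta\}$ and $G\{\Gamma,B\Rightarrow\Delta\}$ / $G\{\Gamma,A\supset B\Rightarrow\Delta\}$; $(\supset_R)$ $G\{\Gamma\Rightarrow\Delta,\langle A\Rightarrow B\rangle\}$ / $G\{\Gamma\Rightarrow\Delta,A\supset B\}$; $(\Box_L)$ $G\{\Gamma,\Box A\Rightarrow\Delta,[\Sigma,A\Rightarrow\Pi]\}$ / $G\{\Gamma,\Box A\Rightarrow\Delta,[\Sigma\Rightarrow\Pi]\}$; $(\Box_R)$ $G\{\Gamma\Rightarrow\Delta,\langle\ \Rightarrow[\ \Rightarrow A]\rangle\}$ / $G\{\Gamma\Rightarrow\Delta,\Box A\}$; $(\Diamond_L)$ $G\{\Gamma\Rightarrow\Delta,[A\Rightarrow\ ]\}$ / $G\{\Gamma,\Diamond A\Rightarrow\Delta\}$; $(\Diamond_R)$ $G\{\Gamma\Rightarrow\Delta,\Diamond A,[\Sigma\Rightarrow\Pi,A]\}$ / $G\{\Gamma\Rightarrow\Delta,\Diamond A,[\Sigma\Rightarrow\Pi]\}$; (trans) $G\{\Gamma,\Gamma'\Rightarrow\Delta,\langle\Gamma',\Sigma\Rightarrow\Pi\rangle\}$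 / $G\{\Gamma,\Gamma'\Rightarrow\Delta,\langle\Sigma\Rightarrow\Pi\rangle\}$; $(\mathrm{inter}_{fc})$ $G\{\Gamma\Rightarrow\Delta,\langle\Sigma\Rightarrow\Pi,[\Lambda\Rightarrow\Theta^*]\rangle,[\Lambda\Rightarrow\Theta]\}$ / $G\{\Gamma\Rightarrow\Delta,\langle\Sigma\Rightarrow\Pi\rangle,[\Lambda\Rightarrow\Theta]\}$; $(\mathrm{inter}_{bc})$ $G\{\Gamma\Rightarrow\Delta,[\Lambda\Rightarrow\Theta,\langle\Sigma\Rightarrow\Pi\rangle],\langle\ \Rightarrow[\Sigma\Rightarrow\Pi]\rangle\}$ / $G\{\Gamma\Rightarrow\Delta,[\Lambda\Rightarrow\Theta,\langle\Sigma\Rightarrow\Pi\rangle]\}$. A sequent is provable if it is the root of a finite tree of rule instances whose leaves are axioms. -}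

module Defs where

open import Data.Nat using (ℕ)
open import Data.List using (List; []; _∷_; _++_)
open import Data.List.Relation.Binary.Permutation.Propositional using (_↭_)

infixr 8 _∧′_
infixr 7 _∨′_
infixr 6 _⊃_
data Fm : Set where
  atom : ℕ → Fm
  bot top : Fm
  _∧′_ _∨′_ _⊃_ : Fm → Fm → Fm
  □ ◇ : Fm → Fm

-- Bi-nested sequents.  The succedent is a list of items: formulas,
-- implication blocks ⟨S⟩ (imp S) and modal blocks [S] (box S).
-- Lists are read as multisets: see _≈S_ and the rule `perm` below.
infix 3 _⇒_
mutual
  data Seq : Set where
    _⇒_ : List Fm → List Item → Seq

  data Item : Set where
    fm  : Fm → Item
    imp : Seq → Item
    box : Seq → Item

mutual
  data _≈S_ : Seq → Seq → Set where
    seq≈ : ∀ {Γ Γ′ Δ Δ′} → Γ ↭ Γ′ → Δ ≈L Δ′ → (Γ ⇒ Δ) ≈S (Γ′ ⇒ Δ′)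

  data _≈I_ : Item → Item → Set where
    fm≈  : ∀ {A} → fm A ≈I fm A
    imp≈ : ∀ {S T} → S ≈S T → imp S ≈I imp T
    box≈ : ∀ {S T} → S ≈S T → box S ≈I box T

  data _≈L_ : List Item → List Item → Set where
    []≈   : [] ≈L []
    cons≈ : ∀ {x y xs ys} → x ≈I y → xs ≈L ys → (x ∷ xs) ≈L (y ∷ ys)
    swap≈ : ∀ {x y xs} → (x ∷ y ∷ xs) ≈L (y ∷ x ∷ xs)
    trans≈ : ∀ {xs ys zs} → xs ≈L ys → ys ≈L zs → xs ≈L zs

data Ctx : Set where
  hole  : Ctx
  impC  : List Fm → List Item → Ctx → Ctx
  boxC  : List Fm → List Item → Ctx → Ctx

infixl 10 _[_]
_[_] : Ctx → Seq → Seq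
hole [ S ] = S
impC Γ Δ G [ S ] = Γ ⇒ Δ ++ imp (G [ S ]) ∷ []
boxC Γ Δ G [ S ] = Γ ⇒ Δ ++ box (G [ S ]) ∷ []

mutual
  star : List Item → List Item
  star [] = []
  star (fm _ ∷ xs) = star xs
  star (imp _ ∷ xs) = star xs
  star (box S ∷ xs) = box (starS S) ∷ star xs

  starS : Seq → Seq
  starS (Λ ⇒ Θ) = Λ ⇒ star Θ

data Provable : Seq → Set where
  perm  : ∀ {S T} → S ≈S T → Provable T → Provable S
  ax⊥   : ∀ G Γ Δ → Provable (G [ bot ∷ Γ ⇒ Δ ])
  ax⊤   : ∀ G Γ Δ → Provable (G [ Γ ⇒ fm top ∷ Δ ])
  axp   : ∀ G Γ Δ p → Provable (G [ atom p ∷ Γ ⇒ fm (atom p) ∷ Δ ])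
  ∧L    : ∀ G Γ Δ A B → Provable (G [ A ∷ B ∷ Γ ⇒ Δ ])
        → Provable (G [ A ∧′ B ∷ Γ ⇒ Δ ])
  ∧R    : ∀ G Γ Δ A B → Provable (G [ Γ ⇒ fm A ∷ Δ ]) → Provable (G [ Γ ⇒ fm B ∷ Δ ])
        → Provable (G [ Γ ⇒ fm (A ∧′ B) ∷ Δ ])
  ∨L    : ∀ G Γ Δ A B → Provable (G [ A ∷ Γ ⇒ Δ ]) → Provable (G [ B ∷ Γ ⇒ Δ ])
        → Provable (G [ A ∨′ B ∷ Γ ⇒ Δ ])
  ∨R    : ∀ G Γ Δ A B → Provable (G [ Γ ⇒ fm A ∷ fm B ∷ Δ ])
        → Provable (G [ Γ ⇒ fm (A ∨′ B) ∷ Δ ])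
  ⊃L    : ∀ G Γ Δ A B → Provable (G [ (A ⊃ B) ∷ Γ ⇒ fm A ∷ Δ ]) → Provable (G [ B ∷ Γ ⇒ Δ ])
        → Provable (G [ (A ⊃ B) ∷ Γ ⇒ Δ ])
  ⊃R    : ∀ G Γ Δ A B → Provable (G [ Γ ⇒ imp (A ∷ [] ⇒ fm B ∷ []) ∷ Δ ])
        → Provable (G [ Γ ⇒ fm (A ⊃ B) ∷ Δ ])
  □L    : ∀ G Γ Δ A Σ Π → Provable (G [ □ A ∷ Γ ⇒ box (A ∷ Σ ⇒ Π) ∷ Δ ])
        → Provable (G [ □ A ∷ Γ ⇒ box (Σ ⇒ Π) ∷ Δ ])
  □R    : ∀ G Γ Δ A → Provable (G [ Γ ⇒ imp ([] ⇒ box ([] ⇒ fm A ∷ []) ∷ []) ∷ Δ ])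
        → Provable (G [ Γ ⇒ fm (□ A) ∷ Δ ])
  ◇L    : ∀ G Γ Δ A → Provable (G [ Γ ⇒ box (A ∷ [] ⇒ []) ∷ Δ ])
        → Provable (G [ ◇ A ∷ Γ ⇒ Δ ])
  ◇R    : ∀ G Γ Δ A Σ Π → Provable (G [ Γ ⇒ fm (◇ A) ∷ box (Σ ⇒ fm A ∷ Π) ∷ Δ ])
        → Provable (G [ Γ ⇒ fm (◇ A) ∷ box (Σ ⇒ Π) ∷ Δ ])
  trans : ∀ G Γ Γ′ Δ Σ Π → Provable (G [ Γ ++ Γ′ ⇒ imp (Γ′ ++ Σ ⇒ Π) ∷ Δ ])
        → Provable (G [ Γ ++ Γ′ ⇒ imp (Σ ⇒ Π) ∷ Δ ])
  interfc : ∀ G Γ Δ Σ Π Λ Θ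
        → Provable (G [ Γ ⇒ imp (Σ ⇒ box (Λ ⇒ star Θ) ∷ Π) ∷ box (Λ ⇒ Θ) ∷ Δ ])
        → Provable (G [ Γ ⇒ imp (Σ ⇒ Π) ∷ box (Λ ⇒ Θ) ∷ Δ ])
  interbc : ∀ G Γ Δ Σ Π Λ Θ
        → Provable (G [ Γ ⇒ box (Λ ⇒ imp (Σ ⇒ Π) ∷ Θ) ∷ imp ([] ⇒ box (Σ ⇒ Π) ∷ []) ∷ Δ ])
        → Provable (G [ Γ ⇒ box (Λ ⇒ imp (Σ ⇒ Π) ∷ Θ) ∷ Δ ])

Admissible-wR Admissible-wL Admissible-wC Admissible-cR Admissible-cL Admissible-∅ : Set
Admissible-wR = ∀ G Γ Δ (O : Item) → Provable (G [ Γ ⇒ Δ ]) → Provable (G [ Γ ⇒ Δ ++ O ∷ [] ])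
Admissible-wL = ∀ G Γ Δ (A : Fm) → Provable (G [ Γ ⇒ Δ ]) → Provable (G [ A ∷ Γ ⇒ Δ ])
Admissible-wC = ∀ G Γ Δ → Provable (Γ ⇒ Δ) → Provable (G [ Γ ⇒ Δ ])
Admissible-cR = ∀ G Γ Δ (O : Item) → Provable (G [ Γ ⇒ Δ ++ O ∷ O ∷ [] ])
              → Provable (G [ Γ ⇒ Δ ++ O ∷ [] ])
Admissible-cL = ∀ G Γ Δ (A : Fm) → Provable (G [ Γ ++ A ∷ A ∷ [] ⇒ Δ ])
              → Provable (G [ Γ ++ A ∷ [] ⇒ Δ ])
Admissible-∅  = ∀ G Γ Δ → Provable (G [ Γ ⇒ Δ ++ imp ([] ⇒ []) ∷ [] ]) → Provable (G [ Γ ⇒ Δ ])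

-- All six rules are instances of one monotonicity principle.  Say that T covers S
-- (S ≼ T) when every antecedent formula of S is available on the left of T and every
-- succedent formula or block of S is available on the right of T, recursively inside
-- blocks, where "available" also allows a formula to be present only through the
-- premises of its invertible rule (A ∧ B on the left through A and B, ◇ A on the left
-- through A in a modal block, ...), and allows an implication block ⟨S⟩ to be covered
-- by the sequent that contains it.  Then every derivation of S can be replayed on any
-- cover T, rule by rule: either T contains the principal formula (and we apply the
-- same rule in T), or it already contains the premise's new material.  Weakening,
-- contraction and removal of ⟨ ⇒ ⟩ only ever shrink or duplicate material, so the
-- conclusion covers the premise.  Weakening into a context is a separate induction.
module Submission where

open import Defs
open import Data.List using (List; []; _∷_; _++_)
open import Data.List.Membership.Propositional using (_∈_)
open import Data.List.Membership.Propositional.Properties using (∈-++⁺ˡ; ∈-++⁺ʳ; ∈-++⁻; ∈-∃++)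
open import Data.List.Properties using (++-identityʳ)
open import Data.List.Relation.Binary.Permutation.Propositional as ↭
  using (_↭_; ↭-refl; ↭-sym; ↭-trans)
open import Data.List.Relation.Binary.Permutation.Propositional.Properties
  using (∈-resp-↭; All-resp-↭; shift; ∷↭∷ʳ)
open import Data.List.Relation.Unary.All as All using (All; []; _∷_)
open import Data.List.Relation.Unary.All.Properties using (++⁺; ++⁻)
open import Data.List.Relation.Unary.Any using (here; there)
open import Data.Product using (_×_; _,_; proj₂; ∃-syntax)
open import Data.Sum using (inj₁; inj₂)
open import Function using (id; _∘_)
open import Relation.Binary.PropositionalEquality using (_≡_; refl; subst; sym; cong)

-- Multiset equality

mutual
  ≈S-refl : ∀ S → S ≈S S
  ≈S-refl (Γ ⇒ Δ) = seq≈ ↭-refl (≈L-refl Δ)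

  ≈L-refl : ∀ Δ → Δ ≈L Δ
  ≈L-refl []      = []≈
  ≈L-refl (x ∷ Δ) = cons≈ (≈I-refl x) (≈L-refl Δ)

  ≈I-refl : ∀ x → x ≈I x
  ≈I-refl (fm A)  = fm≈
  ≈I-refl (imp S) = imp≈ (≈S-refl S)
  ≈I-refl (box S) = box≈ (≈S-refl S)

≈S-trans : ∀ {S T U} → S ≈S T → T ≈S U → S ≈S U
≈S-trans (seq≈ p q) (seq≈ p′ q′) = seq≈ (↭-trans p p′) (trans≈ q q′)

≈I-trans : ∀ {x y z} → x ≈I y → y ≈I z → x ≈I z
≈I-trans fm≈      fm≈       = fm≈
≈I-trans (imp≈ e) (imp≈ e′) = imp≈ (≈S-trans e e′)
≈I-trans (box≈ e) (box≈ e′) = box≈ (≈S-trans e e′)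

↭⇒≈L : ∀ {xs ys} → xs ↭ ys → xs ≈L ys
↭⇒≈L {xs} ↭.refl     = ≈L-refl xs
↭⇒≈L (↭.prep x p)    = cons≈ (≈I-refl x) (↭⇒≈L p)
↭⇒≈L (↭.swap x y p)  = trans≈ swap≈ (cons≈ (≈I-refl y) (cons≈ (≈I-refl x) (↭⇒≈L p)))
↭⇒≈L (↭.trans p q)   = trans≈ (↭⇒≈L p) (↭⇒≈L q)

≈L-prefix : ∀ Δ {ys ys′} → ys ≈L ys′ → (Δ ++ ys) ≈L (Δ ++ ys′)
≈L-prefix []      e = e
≈L-prefix (x ∷ Δ) e = cons≈ (≈I-refl x) (≈L-prefix Δ e)

∈-resp-≈L : ∀ {x L L′} → x ∈ L → L ≈L L′ → ∃[ y ] y ∈ L′ × x ≈I y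
∈-resp-≈L (here refl) (cons≈ e q) = _ , here refl , e
∈-resp-≈L (there m)   (cons≈ e q) with ∈-resp-≈L m q
... | y , m′ , e′ = y , there m′ , e′
∈-resp-≈L {x} (here refl)         swap≈ = x , there (here refl) , ≈I-refl x
∈-resp-≈L {x} (there (here refl)) swap≈ = x , here refl , ≈I-refl x
∈-resp-≈L {x} (there (there m))   swap≈ = x , there (there m) , ≈I-refl x
∈-resp-≈L m (trans≈ q₁ q₂) with ∈-resp-≈L m q₁
... | y , m₁ , e₁ with ∈-resp-≈L m₁ q₂
... | z , m₂ , e₂ = z , m₂ , ≈I-trans e₁ e₂

fill-≈ : ∀ G {S S′} → S ≈S S′ → (G [ S ]) ≈S (G [ S′ ])
fill-≈ hole         e = e
fill-≈ (impC Γ Δ G) e = seq≈ ↭-refl (≈L-prefix Δ (cons≈ (imp≈ (fill-≈ G e)) []≈))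
fill-≈ (boxC Γ Δ G) e = seq≈ ↭-refl (≈L-prefix Δ (cons≈ (box≈ (fill-≈ G e)) []≈))

≈-ant : ∀ {Γ Γ′ Δ} → Γ ↭ Γ′ → (Γ ⇒ Δ) ≈S (Γ′ ⇒ Δ)
≈-ant {Δ = Δ} p = seq≈ p (≈L-refl Δ)

≈-suc : ∀ {Γ Δ Δ′} → Δ ↭ Δ′ → (Γ ⇒ Δ) ≈S (Γ ⇒ Δ′)
≈-suc p = seq≈ ↭-refl (↭⇒≈L p)

∈⇒↭-front : ∀ {A : Set} {x : A} {L} → x ∈ L → ∃[ L′ ] L ↭ x ∷ L′
∈⇒↭-front {x = x} m with ∈-∃++ m
... | ys , zs , refl = ys ++ zs , shift x ys zs

∈⇒↭-back : ∀ {A : Set} {x : A} {L} → x ∈ L → ∃[ L′ ] L ↭ L′ ++ x ∷ []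
∈⇒↭-back m with ∈⇒↭-front m
... | L′ , p = L′ , ↭-trans p (∷↭∷ʳ _ L′)

-- Coverage

antecedent : Seq → List Fm
antecedent (Γ ⇒ Δ) = Γ

succedent : Seq → List Item
succedent (Γ ⇒ Δ) = Δ

mutual
  data LCov : Fm → Seq → Set where
    lmem : ∀ {C T} → C ∈ antecedent T → LCov C T
    l∧   : ∀ {A B T} → LCov A T → LCov B T → LCov (A ∧′ B) T
    l∨₁  : ∀ {A B T} → LCov A T → LCov (A ∨′ B) T
    l∨₂  : ∀ {A B T} → LCov B T → LCov (A ∨′ B) T
    l⊃   : ∀ {A B T} → LCov B T → LCov (A ⊃ B) T
    l◇   : ∀ {A T U} → box U ∈ succedent T → LCov A U → LCov (◇ A) T

  data RCov : Item → Seq → Set where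
    rmem  : ∀ {C T} → fm C ∈ succedent T → RCov (fm C) T
    r∧₁   : ∀ {A B T} → RCov (fm A) T → RCov (fm (A ∧′ B)) T
    r∧₂   : ∀ {A B T} → RCov (fm B) T → RCov (fm (A ∧′ B)) T
    r∨    : ∀ {A B T} → RCov (fm A) T → RCov (fm B) T → RCov (fm (A ∨′ B)) T
    r⊃    : ∀ {A B T} → RCov (imp (A ∷ [] ⇒ fm B ∷ [])) T → RCov (fm (A ⊃ B)) T
    r□    : ∀ {A T} → RCov (imp ([] ⇒ box ([] ⇒ fm A ∷ []) ∷ [])) T → RCov (fm (□ A)) T
    rimp  : ∀ {S T U} → imp U ∈ succedent T → S ≼ U → RCov (imp S) T
    rbox  : ∀ {S T U} → box U ∈ succedent T → S ≼ U → RCov (box S) T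
    rmerge : ∀ {S T} → S ≼ T → RCov (imp S) T

  data _≼_ : Seq → Seq → Set where
    cover : ∀ {Γ Δ T} → All (λ C → LCov C T) Γ → All (λ x → RCov x T) Δ → (Γ ⇒ Δ) ≼ T

infix 4 _⊑_ _⊑₀_

record _⊑_ (N N′ : Seq) : Set where
  field
    mapˡ : ∀ {C} → LCov C N → LCov C N′
    mapʳ : ∀ {x} → RCov x N → RCov x N′
open _⊑_ public

≼-⊑-trans : ∀ {S N N′} → S ≼ N → N ⊑ N′ → S ≼ N′
≼-⊑-trans (cover ls rs) P = cover (All.map (mapˡ P) ls) (All.map (mapʳ P) rs)

⊑-refl : ∀ {N} → N ⊑ N
⊑-refl = record { mapˡ = id ; mapʳ = id }

⊑-trans : ∀ {N M K} → N ⊑ M → M ⊑ K → N ⊑ K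
⊑-trans P Q = record { mapˡ = mapˡ Q ∘ mapˡ P ; mapʳ = mapʳ Q ∘ mapʳ P }

-- It suffices to check N ⊑ N′ on the members of N; the derived cases follow.
record _⊑₀_ (N N′ : Seq) : Set where
  field
    ant⊑  : ∀ {C} → C ∈ antecedent N → LCov C N′
    fm⊑   : ∀ {C} → fm C ∈ succedent N → RCov (fm C) N′
    box⊑  : ∀ {U} → box U ∈ succedent N → ∃[ U′ ] box U′ ∈ succedent N′ × U ⊑ U′
    imp⊑  : ∀ {U} → imp U ∈ succedent N → ∃[ U′ ] imp U′ ∈ succedent N′ × U ⊑ U′
open _⊑₀_ public

module Extend {N N′} (g : N ⊑₀ N′) where
  mutual
    lcov : ∀ {C} → LCov C N → LCov C N′
    lcov (lmem m)  = ant⊑ g m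
    lcov (l∧ p q)  = l∧ (lcov p) (lcov q)
    lcov (l∨₁ p)   = l∨₁ (lcov p)
    lcov (l∨₂ p)   = l∨₂ (lcov p)
    lcov (l⊃ p)    = l⊃ (lcov p)
    lcov (l◇ m p) with box⊑ g m
    ... | _ , m′ , P = l◇ m′ (mapˡ P p)

    rcov : ∀ {x} → RCov x N → RCov x N′
    rcov (rmem m)   = fm⊑ g m
    rcov (r∧₁ p)    = r∧₁ (rcov p)
    rcov (r∧₂ p)    = r∧₂ (rcov p)
    rcov (r∨ p q)   = r∨ (rcov p) (rcov q)
    rcov (r⊃ p)     = r⊃ (rcov p)
    rcov (r□ p)     = r□ (rcov p)
    rcov (rimp m s) with imp⊑ g m
    ... | _ , m′ , P = rimp m′ (≼-⊑-trans s P)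
    rcov (rbox m s) with box⊑ g m
    ... | _ , m′ , P = rbox m′ (≼-⊑-trans s P)
    rcov (rmerge (cover ls rs)) = rmerge (cover (lcovs ls) (rcovs rs))

    lcovs : ∀ {Γ} → All (λ C → LCov C N) Γ → All (λ C → LCov C N′) Γ
    lcovs []       = []
    lcovs (p ∷ ps) = lcov p ∷ lcovs ps

    rcovs : ∀ {Δ} → All (λ x → RCov x N) Δ → All (λ x → RCov x N′) Δ
    rcovs []       = []
    rcovs (p ∷ ps) = rcov p ∷ rcovs ps

⊑₀⇒⊑ : ∀ {N N′} → N ⊑₀ N′ → N ⊑ N′
⊑₀⇒⊑ g = record { mapˡ = Extend.lcov g ; mapʳ = Extend.rcov g }

⊆⇒⊑ : ∀ {N N′} → (∀ {C} → C ∈ antecedent N → C ∈ antecedent N′)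
    → (∀ {x} → x ∈ succedent N → x ∈ succedent N′) → N ⊑ N′
⊆⇒⊑ f g = ⊑₀⇒⊑ record
  { ant⊑ = lmem ∘ f ; fm⊑ = rmem ∘ g
  ; box⊑ = λ m → _ , g m , ⊑-refl ; imp⊑ = λ m → _ , g m , ⊑-refl }

mutual
  ⊆⇒≼ : ∀ {T} S → (∀ {C} → C ∈ antecedent S → C ∈ antecedent T)
      → (∀ {x} → x ∈ succedent S → x ∈ succedent T) → S ≼ T
  ⊆⇒≼ (Γ ⇒ Δ) f g = cover (⊆⇒lcovs Γ f) (⊆⇒rcovs Δ g)

  ⊆⇒lcovs : ∀ {T} Γ → (∀ {C} → C ∈ Γ → C ∈ antecedent T) → All (λ C → LCov C T) Γ
  ⊆⇒lcovs []      f = []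
  ⊆⇒lcovs (C ∷ Γ) f = lmem (f (here refl)) ∷ ⊆⇒lcovs Γ (f ∘ there)

  ⊆⇒rcovs : ∀ {T} Δ → (∀ {x} → x ∈ Δ → x ∈ succedent T) → All (λ x → RCov x T) Δ
  ⊆⇒rcovs []      g = []
  ⊆⇒rcovs (x ∷ Δ) g = ∈⇒rcov x (g (here refl)) ∷ ⊆⇒rcovs Δ (g ∘ there)

  ∈⇒rcov : ∀ {T} x → x ∈ succedent T → RCov x T
  ∈⇒rcov (fm A)  m = rmem m
  ∈⇒rcov (imp S) m = rimp m (⊆⇒≼ S id id)
  ∈⇒rcov (box S) m = rbox m (⊆⇒≼ S id id)

mutual
  lcov-respʳ-≈ : ∀ {T T′ C} → T ≈S T′ → LCov C T → LCov C T′
  lcov-respʳ-≈ (seq≈ p q) (lmem m) = lmem (∈-resp-↭ p m)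
  lcov-respʳ-≈ e (l∧ p q) = l∧ (lcov-respʳ-≈ e p) (lcov-respʳ-≈ e q)
  lcov-respʳ-≈ e (l∨₁ p)  = l∨₁ (lcov-respʳ-≈ e p)
  lcov-respʳ-≈ e (l∨₂ p)  = l∨₂ (lcov-respʳ-≈ e p)
  lcov-respʳ-≈ e (l⊃ p)   = l⊃ (lcov-respʳ-≈ e p)
  lcov-respʳ-≈ (seq≈ p q) (l◇ m x) with ∈-resp-≈L m q
  ... | box _ , m′ , box≈ e = l◇ m′ (lcov-respʳ-≈ e x)

  rcov-respʳ-≈ : ∀ {T T′ x} → T ≈S T′ → RCov x T → RCov x T′
  rcov-respʳ-≈ (seq≈ p q) (rmem m) with ∈-resp-≈L m q
  ... | fm _ , m′ , fm≈ = rmem m′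
  rcov-respʳ-≈ e (r∧₁ x)   = r∧₁ (rcov-respʳ-≈ e x)
  rcov-respʳ-≈ e (r∧₂ x)   = r∧₂ (rcov-respʳ-≈ e x)
  rcov-respʳ-≈ e (r∨ x y)  = r∨ (rcov-respʳ-≈ e x) (rcov-respʳ-≈ e y)
  rcov-respʳ-≈ e (r⊃ x)    = r⊃ (rcov-respʳ-≈ e x)
  rcov-respʳ-≈ e (r□ x)    = r□ (rcov-respʳ-≈ e x)
  rcov-respʳ-≈ (seq≈ p q) (rimp m s) with ∈-resp-≈L m q
  ... | imp _ , m′ , imp≈ e = rimp m′ (≼-respʳ-≈ e s)
  rcov-respʳ-≈ (seq≈ p q) (rbox m s) with ∈-resp-≈L m q
  ... | box _ , m′ , box≈ e = rbox m′ (≼-respʳ-≈ e s)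
  rcov-respʳ-≈ e (rmerge s) = rmerge (≼-respʳ-≈ e s)

  ≼-respʳ-≈ : ∀ {T T′ S} → T ≈S T′ → S ≼ T → S ≼ T′
  ≼-respʳ-≈ e (cover ls rs) = cover (lcovs e ls) (rcovs e rs)
    where
    lcovs : ∀ {T T′ Γ} → T ≈S T′ → All (λ C → LCov C T) Γ → All (λ C → LCov C T′) Γ
    lcovs e []       = []
    lcovs e (p ∷ ps) = lcov-respʳ-≈ e p ∷ lcovs e ps

    rcovs : ∀ {T T′ Δ} → T ≈S T′ → All (λ x → RCov x T) Δ → All (λ x → RCov x T′) Δ
    rcovs e []       = []
    rcovs e (p ∷ ps) = rcov-respʳ-≈ e p ∷ rcovs e ps

≈⇒⊑ : ∀ {T T′} → T ≈S T′ → T ⊑ T′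
≈⇒⊑ e = record { mapˡ = lcov-respʳ-≈ e ; mapʳ = rcov-respʳ-≈ e }

mutual
  ≼-respˡ-≈ : ∀ {S S′ T} → S ≈S S′ → S ≼ T → S′ ≼ T
  ≼-respˡ-≈ (seq≈ p q) (cover ls rs) = cover (All-resp-↭ p ls) (rcovs-resp-≈L q rs)

  rcovs-resp-≈L : ∀ {Δ Δ′ T} → Δ ≈L Δ′ → All (λ x → RCov x T) Δ → All (λ x → RCov x T) Δ′
  rcovs-resp-≈L []≈ []                   = []
  rcovs-resp-≈L (cons≈ e q) (r ∷ rs)     = rcov-resp-≈I e r ∷ rcovs-resp-≈L q rs
  rcovs-resp-≈L swap≈ (r ∷ r′ ∷ rs)      = r′ ∷ r ∷ rs
  rcovs-resp-≈L (trans≈ q₁ q₂) rs        = rcovs-resp-≈L q₂ (rcovs-resp-≈L q₁ rs)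

  rcov-resp-≈I : ∀ {x y T} → x ≈I y → RCov x T → RCov y T
  rcov-resp-≈I fm≈      r          = r
  rcov-resp-≈I (imp≈ e) (rimp m s) = rimp m (≼-respˡ-≈ e s)
  rcov-resp-≈I (imp≈ e) (rmerge s) = rmerge (≼-respˡ-≈ e s)
  rcov-resp-≈I (box≈ e) (rbox m s) = rbox m (≼-respˡ-≈ e s)

⊑-midImp : ∀ {Γ U U′} P Δ → U ⊑ U′ → (Γ ⇒ P ++ imp U ∷ Δ) ⊑ (Γ ⇒ P ++ imp U′ ∷ Δ)
⊑-midImp {Γ} {U} {U′} P Δ PU = ⊑₀⇒⊑ record
  { ant⊑ = lmem ; fm⊑ = fm⊑′ ; box⊑ = box⊑′ ; imp⊑ = imp⊑′ }
  where
  fm⊑′ : ∀ {C} → fm C ∈ P ++ imp U ∷ Δ → RCov (fm C) (Γ ⇒ P ++ imp U′ ∷ Δ)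
  fm⊑′ m with ∈-++⁻ P m
  ... | inj₁ m′         = rmem (∈-++⁺ˡ m′)
  ... | inj₂ (there m′) = rmem (∈-++⁺ʳ P (there m′))
  box⊑′ : ∀ {V} → box V ∈ P ++ imp U ∷ Δ → ∃[ V′ ] box V′ ∈ P ++ imp U′ ∷ Δ × V ⊑ V′
  box⊑′ m with ∈-++⁻ P m
  ... | inj₁ m′         = _ , ∈-++⁺ˡ m′ , ⊑-refl
  ... | inj₂ (there m′) = _ , ∈-++⁺ʳ P (there m′) , ⊑-refl
  imp⊑′ : ∀ {V} → imp V ∈ P ++ imp U ∷ Δ → ∃[ V′ ] imp V′ ∈ P ++ imp U′ ∷ Δ × V ⊑ V′
  imp⊑′ m with ∈-++⁻ P m
  ... | inj₁ m′           = _ , ∈-++⁺ˡ m′ , ⊑-refl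
  ... | inj₂ (here refl)  = U′ , ∈-++⁺ʳ P (here refl) , PU
  ... | inj₂ (there m′)   = _ , ∈-++⁺ʳ P (there m′) , ⊑-refl

⊑-midBox : ∀ {Γ U U′} P Δ → U ⊑ U′ → (Γ ⇒ P ++ box U ∷ Δ) ⊑ (Γ ⇒ P ++ box U′ ∷ Δ)
⊑-midBox {Γ} {U} {U′} P Δ PU = ⊑₀⇒⊑ record
  { ant⊑ = lmem ; fm⊑ = fm⊑′ ; box⊑ = box⊑′ ; imp⊑ = imp⊑′ }
  where
  fm⊑′ : ∀ {C} → fm C ∈ P ++ box U ∷ Δ → RCov (fm C) (Γ ⇒ P ++ box U′ ∷ Δ)
  fm⊑′ m with ∈-++⁻ P m
  ... | inj₁ m′         = rmem (∈-++⁺ˡ m′)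
  ... | inj₂ (there m′) = rmem (∈-++⁺ʳ P (there m′))
  box⊑′ : ∀ {V} → box V ∈ P ++ box U ∷ Δ → ∃[ V′ ] box V′ ∈ P ++ box U′ ∷ Δ × V ⊑ V′
  box⊑′ m with ∈-++⁻ P m
  ... | inj₁ m′           = _ , ∈-++⁺ˡ m′ , ⊑-refl
  ... | inj₂ (here refl)  = U′ , ∈-++⁺ʳ P (here refl) , PU
  ... | inj₂ (there m′)   = _ , ∈-++⁺ʳ P (there m′) , ⊑-refl
  imp⊑′ : ∀ {V} → imp V ∈ P ++ box U ∷ Δ → ∃[ V′ ] imp V′ ∈ P ++ box U′ ∷ Δ × V ⊑ V′
  imp⊑′ m with ∈-++⁻ P m
  ... | inj₁ m′         = _ , ∈-++⁺ˡ m′ , ⊑-refl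
  ... | inj₂ (there m′) = _ , ∈-++⁺ʳ P (there m′) , ⊑-refl

⊑-fill : ∀ G {N N′} → N ⊑ N′ → (G [ N ]) ⊑ (G [ N′ ])
⊑-fill hole         P = P
⊑-fill (impC Γ Δ G) P = ⊑-midImp Δ [] (⊑-fill G P)
⊑-fill (boxC Γ Δ G) P = ⊑-midBox Δ [] (⊑-fill G P)

≼-fill : ∀ G {S S′} → S ≼ S′ → (G [ S ]) ≼ (G [ S′ ])
≼-fill hole         s = s
≼-fill (impC Γ Δ G) s =
  cover (⊆⇒lcovs Γ id) (++⁺ (⊆⇒rcovs Δ ∈-++⁺ˡ) (rimp (∈-++⁺ʳ Δ (here refl)) (≼-fill G s) ∷ []))
≼-fill (boxC Γ Δ G) s =
  cover (⊆⇒lcovs Γ id) (++⁺ (⊆⇒rcovs Δ ∈-++⁺ˡ) (rbox (∈-++⁺ʳ Δ (here refl)) (≼-fill G s) ∷ []))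

-- A cover T of G [ X ] is, up to ≈S, of the form G′ [ N ] with X ≼ N, and
-- enlarging N to any N′ ⊒ N keeps G′ [ N′ ] a cover of G [ Y ] whenever Y ≼ N′.
record Located (G : Ctx) (X T : Seq) : Set where
  field
    ctx    : Ctx
    focus  : Seq
    split  : T ≈S (ctx [ focus ])
    covers : X ≼ focus
    refill : ∀ Y N′ → Y ≼ N′ → focus ⊑ N′ → (G [ Y ]) ≼ (ctx [ N′ ])
open Located

locate : ∀ G X T → (G [ X ]) ≼ T → Located G X T
locate hole X T s = record
  { ctx = hole ; focus = T ; split = ≈S-refl T ; covers = s ; refill = λ _ _ y _ → y }
locate (impC Γ Δ G) X (Γt ⇒ Δt) (cover ls rs) with ++⁻ Δ rs
... | rsΔ , (rimp {U = U} m s ∷ []) with locate G X U s | ∈⇒↭-back m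
... | R | Δr , p = record
  { ctx = impC Γt Δr (ctx R) ; focus = focus R ; split = e ; covers = covers R
  ; refill = λ Y N′ y pr →
      let P = ⊑-trans (≈⇒⊑ e) (⊑-fill (impC Γt Δr (ctx R)) pr)
      in cover (All.map (mapˡ P) ls)
               (++⁺ (All.map (mapʳ P) rsΔ) (rimp (∈-++⁺ʳ Δr (here refl)) (refill R Y N′ y pr) ∷ [])) }
  where e = seq≈ ↭-refl (trans≈ (↭⇒≈L p) (≈L-prefix Δr (cons≈ (imp≈ (split R)) []≈)))
locate (impC Γ Δ G) X T (cover ls rs) | rsΔ , (rmerge s ∷ []) with locate G X T s
... | R = record
  { ctx = ctx R ; focus = focus R ; split = split R ; covers = covers R
  ; refill = λ Y N′ y pr →
      let P = ⊑-trans (≈⇒⊑ (split R)) (⊑-fill (ctx R) pr)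
      in cover (All.map (mapˡ P) ls) (++⁺ (All.map (mapʳ P) rsΔ) (rmerge (refill R Y N′ y pr) ∷ [])) }
locate (boxC Γ Δ G) X (Γt ⇒ Δt) (cover ls rs) with ++⁻ Δ rs
... | rsΔ , (rbox {U = U} m s ∷ []) with locate G X U s | ∈⇒↭-back m
... | R | Δr , p = record
  { ctx = boxC Γt Δr (ctx R) ; focus = focus R ; split = e ; covers = covers R
  ; refill = λ Y N′ y pr →
      let P = ⊑-trans (≈⇒⊑ e) (⊑-fill (boxC Γt Δr (ctx R)) pr)
      in cover (All.map (mapˡ P) ls)
               (++⁺ (All.map (mapʳ P) rsΔ) (rbox (∈-++⁺ʳ Δr (here refl)) (refill R Y N′ y pr) ∷ [])) }
  where e = seq≈ ↭-refl (trans≈ (↭⇒≈L p) (≈L-prefix Δr (cons≈ (box≈ (split R)) []≈)))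

-- Local positive parts

box∈star : ∀ {U Δ} → box U ∈ Δ → box (starS U) ∈ star Δ
box∈star {Δ = fm _ ∷ Δ}  (there m)   = box∈star m
box∈star {Δ = imp _ ∷ Δ} (there m)   = box∈star m
box∈star {Δ = box _ ∷ Δ} (here refl) = here refl
box∈star {Δ = box _ ∷ Δ} (there m)   = there (box∈star m)

lcov-starS : ∀ {A T} → LCov A T → LCov A (starS T)
lcov-starS {T = Γ ⇒ Δ} (lmem m) = lmem m
lcov-starS (l∧ p q)  = l∧ (lcov-starS p) (lcov-starS q)
lcov-starS (l∨₁ p)   = l∨₁ (lcov-starS p)
lcov-starS (l∨₂ p)   = l∨₂ (lcov-starS p)
lcov-starS (l⊃ p)    = l⊃ (lcov-starS p)
lcov-starS {T = Γ ⇒ Δ} (l◇ m p) = l◇ (box∈star m) (lcov-starS p)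

mutual
  starS-mono : ∀ {S T} → S ≼ T → starS S ≼ starS T
  starS-mono (cover ls rs) = cover (All.map lcov-starS ls) (rcovs-star rs)

  rcovs-star : ∀ {Δ T} → All (λ x → RCov x T) Δ → All (λ x → RCov x (starS T)) (star Δ)
  rcovs-star [] = []
  rcovs-star {fm _ ∷ Δ}  (r ∷ rs) = rcovs-star rs
  rcovs-star {imp _ ∷ Δ} (r ∷ rs) = rcovs-star rs
  rcovs-star {box _ ∷ Δ} {Γ ⇒ Θ} (rbox m s ∷ rs) = rbox (box∈star m) (starS-mono s) ∷ rcovs-star rs

mutual
  starS-≼ : ∀ {S T} → S ≼ T → starS S ≼ T
  starS-≼ (cover ls rs) = cover ls (rcovs-star-≼ rs)

  rcovs-star-≼ : ∀ {Δ T} → All (λ x → RCov x T) Δ → All (λ x → RCov x T) (star Δ)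
  rcovs-star-≼ [] = []
  rcovs-star-≼ {fm _ ∷ Δ}  (r ∷ rs) = rcovs-star-≼ rs
  rcovs-star-≼ {imp _ ∷ Δ} (r ∷ rs) = rcovs-star-≼ rs
  rcovs-star-≼ {box _ ∷ Δ} (rbox m s ∷ rs) = rbox m (starS-≼ s) ∷ rcovs-star-≼ rs

lcov-into-imp : ∀ {C Γ U Δ Σ Π} → LCov C (Γ ⇒ imp U ∷ Δ) → LCov C (Γ ++ Σ ⇒ star Δ ++ Π)
lcov-into-imp (lmem m) = lmem (∈-++⁺ˡ m)
lcov-into-imp (l∧ p q) = l∧ (lcov-into-imp p) (lcov-into-imp q)
lcov-into-imp (l∨₁ p)  = l∨₁ (lcov-into-imp p)
lcov-into-imp (l∨₂ p)  = l∨₂ (lcov-into-imp p)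
lcov-into-imp (l⊃ p)   = l⊃ (lcov-into-imp p)
lcov-into-imp (l◇ (there m) p) = l◇ (∈-++⁺ˡ (box∈star m)) (lcov-starS p)

interfc-all : ∀ G Γ Σ Π D → Provable (G [ Γ ⇒ imp (Σ ⇒ star D ++ Π) ∷ D ])
            → Provable (G [ Γ ⇒ imp (Σ ⇒ Π) ∷ D ])
interfc-all G Γ Σ Π D d = fix (go D [] (unfix d))
  where
  fix : ∀ {y} → Provable (G [ Γ ⇒ y ∷ D ++ [] ]) → Provable (G [ Γ ⇒ y ∷ D ])
  fix = subst (λ L → Provable (G [ Γ ⇒ _ ∷ L ])) (++-identityʳ D)

  unfix : ∀ {y} → Provable (G [ Γ ⇒ y ∷ D ]) → Provable (G [ Γ ⇒ y ∷ D ++ [] ])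
  unfix = subst (λ L → Provable (G [ Γ ⇒ _ ∷ L ])) (sym (++-identityʳ D))

  permAfter : ∀ {y L L′} → L ↭ L′ → Provable (G [ Γ ⇒ y ∷ L′ ]) → Provable (G [ Γ ⇒ y ∷ L ])
  permAfter {y} p = perm (fill-≈ G (seq≈ ↭-refl (cons≈ (≈I-refl y) (↭⇒≈L p))))

  absorb : ∀ x D E → Provable (G [ Γ ⇒ imp (Σ ⇒ star (x ∷ D) ++ Π) ∷ x ∷ D ++ E ])
         → Provable (G [ Γ ⇒ imp (Σ ⇒ star D ++ Π) ∷ x ∷ D ++ E ])
  absorb (fm A)        D E d = d
  absorb (imp S)       D E d = d
  absorb (box (Λ ⇒ Θ)) D E d = interfc G Γ (D ++ E) Σ (star D ++ Π) Λ Θ d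

  go : ∀ D E → Provable (G [ Γ ⇒ imp (Σ ⇒ star D ++ Π) ∷ D ++ E ])
     → Provable (G [ Γ ⇒ imp (Σ ⇒ Π) ∷ D ++ E ])
  go []      E d = d
  go (x ∷ D) E d =
    permAfter (↭-sym (shift x D E)) (go D (x ∷ E) (permAfter (shift x D E) (absorb x D E d)))

-- Replaying a rule on a cover

Premise : Seq → Ctx → Seq → Set
Premise Y G N = ∀ N′ → Y ≼ N′ → N ⊑ N′ → Provable (G [ N′ ])

⊑-unfoldʳ : ∀ {Γ C Δ} ys → RCov (fm C) (Γ ⇒ ys ++ Δ) → (Γ ⇒ fm C ∷ Δ) ⊑ (Γ ⇒ ys ++ Δ)
⊑-unfoldʳ {Γ} {C} {Δ} ys r = ⊑₀⇒⊑ record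
  { ant⊑ = lmem ; fm⊑ = fm⊑′
  ; box⊑ = λ { (there m) → _ , ∈-++⁺ʳ ys m , ⊑-refl }
  ; imp⊑ = λ { (there m) → _ , ∈-++⁺ʳ ys m , ⊑-refl } }
  where
  fm⊑′ : ∀ {D} → fm D ∈ fm C ∷ Δ → RCov (fm D) (Γ ⇒ ys ++ Δ)
  fm⊑′ (here refl) = r
  fm⊑′ (there m)   = rmem (∈-++⁺ʳ ys m)

⊑-unfoldˡ : ∀ {C Γ Δ} zs → LCov C (zs ++ Γ ⇒ Δ) → (C ∷ Γ ⇒ Δ) ⊑ (zs ++ Γ ⇒ Δ)
⊑-unfoldˡ {C} {Γ} {Δ} zs l = ⊑₀⇒⊑ record
  { ant⊑ = ant⊑′ ; fm⊑ = rmem ; box⊑ = λ m → _ , m , ⊑-refl ; imp⊑ = λ m → _ , m , ⊑-refl }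
  where
  ant⊑′ : ∀ {D} → D ∈ C ∷ Γ → LCov D (zs ++ Γ ⇒ Δ)
  ant⊑′ (here refl) = l
  ant⊑′ (there m)   = lmem (∈-++⁺ʳ zs m)

replay-ax⊥ : ∀ G N Γ Δ → (bot ∷ Γ ⇒ Δ) ≼ N → Provable (G [ N ])
replay-ax⊥ G (Γn ⇒ Δn) Γ Δ (cover (lmem m ∷ _) _) with ∈⇒↭-front m
... | Γr , p = perm (fill-≈ G (≈-ant p)) (ax⊥ G Γr Δn)

replay-ax⊤ : ∀ G N Γ Δ → (Γ ⇒ fm top ∷ Δ) ≼ N → Provable (G [ N ])
replay-ax⊤ G (Γn ⇒ Δn) Γ Δ (cover _ (rmem m ∷ _)) with ∈⇒↭-front m
... | Δr , p = perm (fill-≈ G (≈-suc p)) (ax⊤ G Γn Δr)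

replay-axp : ∀ G N Γ Δ q → (atom q ∷ Γ ⇒ fm (atom q) ∷ Δ) ≼ N → Provable (G [ N ])
replay-axp G (Γn ⇒ Δn) Γ Δ q (cover (lmem m₁ ∷ _) (rmem m₂ ∷ _)) with ∈⇒↭-front m₁ | ∈⇒↭-front m₂
... | Γr , p₁ | Δr , p₂ = perm (fill-≈ G (seq≈ p₁ (↭⇒≈L p₂))) (axp G Γr Δr q)

replay-∧L : ∀ G N Γ Δ A B → (A ∧′ B ∷ Γ ⇒ Δ) ≼ N → Premise (A ∷ B ∷ Γ ⇒ Δ) G N → Provable (G [ N ])
replay-∧L G N Γ Δ A B (cover (l∧ p q ∷ ls) rs) h = h N (cover (p ∷ q ∷ ls) rs) ⊑-refl
replay-∧L G (Γn ⇒ Δn) Γ Δ A B (cover (lmem m ∷ ls) rs) h with ∈⇒↭-front m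
... | Γr , p =
  let P = ⊑-trans (≈⇒⊑ (≈-ant p)) (⊑-unfoldˡ (A ∷ B ∷ []) (l∧ (lmem (here refl)) (lmem (there (here refl)))))
  in perm (fill-≈ G (≈-ant p)) (∧L G Γr Δn A B
       (h _ (cover (lmem (here refl) ∷ lmem (there (here refl)) ∷ All.map (mapˡ P) ls) (All.map (mapʳ P) rs)) P))

replay-∨L : ∀ G N Γ Δ A B → (A ∨′ B ∷ Γ ⇒ Δ) ≼ N
          → Premise (A ∷ Γ ⇒ Δ) G N → Premise (B ∷ Γ ⇒ Δ) G N → Provable (G [ N ])
replay-∨L G N Γ Δ A B (cover (l∨₁ q ∷ ls) rs) h₁ h₂ = h₁ N (cover (q ∷ ls) rs) ⊑-refl
replay-∨L G N Γ Δ A B (cover (l∨₂ q ∷ ls) rs) h₁ h₂ = h₂ N (cover (q ∷ ls) rs) ⊑-refl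
replay-∨L G (Γn ⇒ Δn) Γ Δ A B (cover (lmem m ∷ ls) rs) h₁ h₂ with ∈⇒↭-front m
... | Γr , p =
  let P₁ = ⊑-trans (≈⇒⊑ (≈-ant p)) (⊑-unfoldˡ (A ∷ []) (l∨₁ (lmem (here refl))))
      P₂ = ⊑-trans (≈⇒⊑ (≈-ant p)) (⊑-unfoldˡ (B ∷ []) (l∨₂ (lmem (here refl))))
  in perm (fill-≈ G (≈-ant p)) (∨L G Γr Δn A B
       (h₁ _ (cover (lmem (here refl) ∷ All.map (mapˡ P₁) ls) (All.map (mapʳ P₁) rs)) P₁)
       (h₂ _ (cover (lmem (here refl) ∷ All.map (mapˡ P₂) ls) (All.map (mapʳ P₂) rs)) P₂))

replay-⊃L : ∀ G N Γ Δ A B → ((A ⊃ B) ∷ Γ ⇒ Δ) ≼ N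
          → Premise ((A ⊃ B) ∷ Γ ⇒ fm A ∷ Δ) G N → Premise (B ∷ Γ ⇒ Δ) G N → Provable (G [ N ])
replay-⊃L G N Γ Δ A B (cover (l⊃ q ∷ ls) rs) h₁ h₂ = h₂ N (cover (q ∷ ls) rs) ⊑-refl
replay-⊃L G (Γn ⇒ Δn) Γ Δ A B (cover (lmem m ∷ ls) rs) h₁ h₂ with ∈⇒↭-front m
... | Γr , p =
  let P₁ = ⊑-trans (≈⇒⊑ (≈-ant p)) (⊆⇒⊑ id there)
      P₂ = ⊑-trans (≈⇒⊑ (≈-ant p)) (⊑-unfoldˡ (B ∷ []) (l⊃ (lmem (here refl))))
  in perm (fill-≈ G (≈-ant p)) (⊃L G Γr Δn A B
       (h₁ _ (cover (lmem (here refl) ∷ All.map (mapˡ P₁) ls) (rmem (here refl) ∷ All.map (mapʳ P₁) rs)) P₁)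
       (h₂ _ (cover (lmem (here refl) ∷ All.map (mapˡ P₂) ls) (All.map (mapʳ P₂) rs)) P₂))

replay-∧R : ∀ G N Γ Δ A B → (Γ ⇒ fm (A ∧′ B) ∷ Δ) ≼ N
          → Premise (Γ ⇒ fm A ∷ Δ) G N → Premise (Γ ⇒ fm B ∷ Δ) G N → Provable (G [ N ])
replay-∧R G N Γ Δ A B (cover ls (r∧₁ q ∷ rs)) h₁ h₂ = h₁ N (cover ls (q ∷ rs)) ⊑-refl
replay-∧R G N Γ Δ A B (cover ls (r∧₂ q ∷ rs)) h₁ h₂ = h₂ N (cover ls (q ∷ rs)) ⊑-refl
replay-∧R G (Γn ⇒ Δn) Γ Δ A B (cover ls (rmem m ∷ rs)) h₁ h₂ with ∈⇒↭-front m
... | Δr , p =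
  let P₁ = ⊑-trans (≈⇒⊑ (≈-suc p)) (⊑-unfoldʳ (fm A ∷ []) (r∧₁ (rmem (here refl))))
      P₂ = ⊑-trans (≈⇒⊑ (≈-suc p)) (⊑-unfoldʳ (fm B ∷ []) (r∧₂ (rmem (here refl))))
  in perm (fill-≈ G (≈-suc p)) (∧R G Γn Δr A B
       (h₁ _ (cover (All.map (mapˡ P₁) ls) (rmem (here refl) ∷ All.map (mapʳ P₁) rs)) P₁)
       (h₂ _ (cover (All.map (mapˡ P₂) ls) (rmem (here refl) ∷ All.map (mapʳ P₂) rs)) P₂))

replay-∨R : ∀ G N Γ Δ A B → (Γ ⇒ fm (A ∨′ B) ∷ Δ) ≼ N → Premise (Γ ⇒ fm A ∷ fm B ∷ Δ) G N → Provable (G [ N ])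
replay-∨R G N Γ Δ A B (cover ls (r∨ q₁ q₂ ∷ rs)) h = h N (cover ls (q₁ ∷ q₂ ∷ rs)) ⊑-refl
replay-∨R G (Γn ⇒ Δn) Γ Δ A B (cover ls (rmem m ∷ rs)) h with ∈⇒↭-front m
... | Δr , p =
  let P = ⊑-trans (≈⇒⊑ (≈-suc p))
            (⊑-unfoldʳ (fm A ∷ fm B ∷ []) (r∨ (rmem (here refl)) (rmem (there (here refl)))))
  in perm (fill-≈ G (≈-suc p)) (∨R G Γn Δr A B
       (h _ (cover (All.map (mapˡ P) ls) (rmem (here refl) ∷ rmem (there (here refl)) ∷ All.map (mapʳ P) rs)) P))

replay-⊃R : ∀ G N Γ Δ A B → (Γ ⇒ fm (A ⊃ B) ∷ Δ) ≼ N
          → Premise (Γ ⇒ imp (A ∷ [] ⇒ fm B ∷ []) ∷ Δ) G N → Provable (G [ N ])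
replay-⊃R G N Γ Δ A B (cover ls (r⊃ q ∷ rs)) h = h N (cover ls (q ∷ rs)) ⊑-refl
replay-⊃R G (Γn ⇒ Δn) Γ Δ A B (cover ls (rmem m ∷ rs)) h with ∈⇒↭-front m
... | Δr , p =
  let P = ⊑-trans (≈⇒⊑ (≈-suc p)) (⊑-unfoldʳ (imp (A ∷ [] ⇒ fm B ∷ []) ∷ []) (r⊃ (∈⇒rcov _ (here refl))))
  in perm (fill-≈ G (≈-suc p)) (⊃R G Γn Δr A B
       (h _ (cover (All.map (mapˡ P) ls) (∈⇒rcov _ (here refl) ∷ All.map (mapʳ P) rs)) P))

replay-□R : ∀ G N Γ Δ A → (Γ ⇒ fm (□ A) ∷ Δ) ≼ N
          → Premise (Γ ⇒ imp ([] ⇒ box ([] ⇒ fm A ∷ []) ∷ []) ∷ Δ) G N → Provable (G [ N ])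
replay-□R G N Γ Δ A (cover ls (r□ q ∷ rs)) h = h N (cover ls (q ∷ rs)) ⊑-refl
replay-□R G (Γn ⇒ Δn) Γ Δ A (cover ls (rmem m ∷ rs)) h with ∈⇒↭-front m
... | Δr , p =
  let P = ⊑-trans (≈⇒⊑ (≈-suc p))
            (⊑-unfoldʳ (imp ([] ⇒ box ([] ⇒ fm A ∷ []) ∷ []) ∷ []) (r□ (∈⇒rcov _ (here refl))))
  in perm (fill-≈ G (≈-suc p)) (□R G Γn Δr A
       (h _ (cover (All.map (mapˡ P) ls) (∈⇒rcov _ (here refl) ∷ All.map (mapʳ P) rs)) P))

replay-◇L : ∀ G N Γ Δ A → (◇ A ∷ Γ ⇒ Δ) ≼ N → Premise (Γ ⇒ box (A ∷ [] ⇒ []) ∷ Δ) G N → Provable (G [ N ])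
replay-◇L G N Γ Δ A (cover (l◇ m q ∷ ls) rs) h = h N (cover ls (rbox m (cover (q ∷ []) []) ∷ rs)) ⊑-refl
replay-◇L G (Γn ⇒ Δn) Γ Δ A (cover (lmem m ∷ ls) rs) h with ∈⇒↭-front m
... | Γr , p =
  let g : (◇ A ∷ Γr ⇒ Δn) ⊑₀ (Γr ⇒ box (A ∷ [] ⇒ []) ∷ Δn)
      g = record { ant⊑ = λ { (here refl) → l◇ (here refl) (lmem (here refl)) ; (there m′) → lmem m′ }
                 ; fm⊑  = λ m′ → rmem (there m′)
                 ; box⊑ = λ m′ → _ , there m′ , ⊑-refl ; imp⊑ = λ m′ → _ , there m′ , ⊑-refl }
      P = ⊑-trans (≈⇒⊑ (≈-ant p)) (⊑₀⇒⊑ g)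
  in perm (fill-≈ G (≈-ant p)) (◇L G Γr Δn A
       (h _ (cover (All.map (mapˡ P) ls)
                   (rbox (here refl) (cover (lmem (here refl) ∷ []) []) ∷ All.map (mapʳ P) rs)) P))

replay-□L : ∀ G N Γ Δ A Σ Π → (□ A ∷ Γ ⇒ box (Σ ⇒ Π) ∷ Δ) ≼ N
          → Premise (□ A ∷ Γ ⇒ box (A ∷ Σ ⇒ Π) ∷ Δ) G N → Provable (G [ N ])
replay-□L G (Γn ⇒ Δn) Γ Δ A Σ Π (cover (lmem m₁ ∷ ls) (rbox {U = Σ₁ ⇒ Π₁} m₂ (cover lsΣ rsΠ) ∷ rs)) h
  with ∈⇒↭-front m₁ | ∈⇒↭-front m₂
... | Γr , p₁ | Δr , p₂ =
  let e = seq≈ p₁ (↭⇒≈L p₂)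
      Q = ⊆⇒⊑ {Σ₁ ⇒ Π₁} {A ∷ Σ₁ ⇒ Π₁} there id
      P = ⊑-trans (≈⇒⊑ e) (⊑-midBox [] Δr Q)
  in perm (fill-≈ G e) (□L G Γr Δr A Σ₁ Π₁
       (h _ (cover (lmem (here refl) ∷ All.map (mapˡ P) ls)
                   (rbox (here refl) (cover (lmem (here refl) ∷ All.map (mapˡ Q) lsΣ) (All.map (mapʳ Q) rsΠ))
                    ∷ All.map (mapʳ P) rs)) P))

replay-◇R : ∀ G N Γ Δ A Σ Π → (Γ ⇒ fm (◇ A) ∷ box (Σ ⇒ Π) ∷ Δ) ≼ N
          → Premise (Γ ⇒ fm (◇ A) ∷ box (Σ ⇒ fm A ∷ Π) ∷ Δ) G N → Provable (G [ N ])
replay-◇R G (Γn ⇒ Δn) Γ Δ A Σ Π (cover ls (rmem m₁ ∷ rbox {U = Σ₁ ⇒ Π₁} m₂ (cover lsΣ rsΠ) ∷ rs)) h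
  with ∈⇒↭-front m₁
... | Δ₁ , p with ∈-resp-↭ p m₂
... | there m₂′ with ∈⇒↭-front m₂′
... | Δr , p′ =
  let e = ≈-suc (↭-trans p (↭.prep _ p′))
      Q = ⊆⇒⊑ {Σ₁ ⇒ Π₁} {Σ₁ ⇒ fm A ∷ Π₁} id there
      P = ⊑-trans (≈⇒⊑ e) (⊑-midBox (fm (◇ A) ∷ []) Δr Q)
  in perm (fill-≈ G e) (◇R G Γn Δr A Σ₁ Π₁
       (h _ (cover (All.map (mapˡ P) ls)
                   (rmem (here refl)
                    ∷ rbox (there (here refl)) (cover (All.map (mapˡ Q) lsΣ) (rmem (here refl) ∷ All.map (mapʳ Q) rsΠ))
                    ∷ All.map (mapʳ P) rs)) P))

-- When the implication block of (trans) or (inter_fc) is matched by an existing block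
-- ⟨U⟩ of the cover, the premise's new formulas are covered inside ⟨U⟩ only after
-- copying Γn (by trans) and Δr* (by inter_fc) into it, since a formula of the outer
-- antecedent may be covered there only through an outer modal block (l◇).
replay-trans : ∀ G N Γ Γ′ Δ Σ Π → (Γ ++ Γ′ ⇒ imp (Σ ⇒ Π) ∷ Δ) ≼ N
             → Premise (Γ ++ Γ′ ⇒ imp (Γ′ ++ Σ ⇒ Π) ∷ Δ) G N → Provable (G [ N ])
replay-trans G N Γ Γ′ Δ Σ Π (cover ls (rmerge (cover lsΣ rsΠ) ∷ rs)) h =
  h N (cover ls (rmerge (cover (++⁺ (proj₂ (++⁻ Γ ls)) lsΣ) rsΠ) ∷ rs)) ⊑-refl
replay-trans G (Γn ⇒ Δn) Γ Γ′ Δ Σ Π (cover ls (rimp {U = Σ₁ ⇒ Π₁} m (cover lsΣ rsΠ) ∷ rs)) h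
  with ∈⇒↭-front m
... | Δr , p =
  let e = ≈-suc {Γn} p
      Q = ⊆⇒⊑ {Σ₁ ⇒ Π₁} {Γn ++ Σ₁ ⇒ star Δr ++ Π₁} (∈-++⁺ʳ Γn) (∈-++⁺ʳ (star Δr))
      P = ⊑-trans (≈⇒⊑ e) (⊑-midImp [] Δr Q)
      y = cover (All.map (mapˡ P) ls)
                (rimp (here refl)
                      (cover (++⁺ (All.map (lcov-into-imp ∘ lcov-respʳ-≈ e) (proj₂ (++⁻ Γ ls)))
                                  (All.map (mapˡ Q) lsΣ))
                             (All.map (mapʳ Q) rsΠ))
                 ∷ All.map (mapʳ P) rs)
  in perm (fill-≈ G e) (trans G [] Γn Δr Σ₁ Π₁ (interfc-all G Γn (Γn ++ Σ₁) Π₁ Δr (h _ y P)))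

replay-interfc : ∀ G N Γ Δ Σ Π Λ Θ → (Γ ⇒ imp (Σ ⇒ Π) ∷ box (Λ ⇒ Θ) ∷ Δ) ≼ N
               → Premise (Γ ⇒ imp (Σ ⇒ box (Λ ⇒ star Θ) ∷ Π) ∷ box (Λ ⇒ Θ) ∷ Δ) G N → Provable (G [ N ])
replay-interfc G N Γ Δ Σ Π Λ Θ (cover ls (rmerge (cover lsΣ rsΠ) ∷ rbox m₂ s₂ ∷ rs)) h =
  h N (cover ls (rmerge (cover lsΣ (rbox m₂ (starS-≼ s₂) ∷ rsΠ)) ∷ rbox m₂ s₂ ∷ rs)) ⊑-refl
replay-interfc G (Γn ⇒ Δn) Γ Δ Σ Π Λ Θ (cover ls (rimp {U = Σ₁ ⇒ Π₁} m₁ (cover lsΣ rsΠ) ∷ rbox m₂ s₂ ∷ rs)) h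
  with ∈⇒↭-front m₁
... | Δr , p with ∈-resp-↭ p m₂
... | there m₂′ =
  let e = ≈-suc {Γn} p
      Q = ⊆⇒⊑ {Σ₁ ⇒ Π₁} {Σ₁ ⇒ star Δr ++ Π₁} id (∈-++⁺ʳ (star Δr))
      P = ⊑-trans (≈⇒⊑ e) (⊑-midImp [] Δr Q)
      y = cover (All.map (mapˡ P) ls)
                (rimp (here refl) (cover (All.map (mapˡ Q) lsΣ)
                                         (rbox (∈-++⁺ˡ (box∈star m₂′)) (starS-mono s₂) ∷ All.map (mapʳ Q) rsΠ))
                 ∷ mapʳ P (rbox m₂ s₂) ∷ All.map (mapʳ P) rs)
  in perm (fill-≈ G e) (interfc-all G Γn Σ₁ Π₁ Δr (h _ y P))

replay-interbc : ∀ G N Γ Δ Σ Π Λ Θ → (Γ ⇒ box (Λ ⇒ imp (Σ ⇒ Π) ∷ Θ) ∷ Δ) ≼ N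
               → Premise (Γ ⇒ box (Λ ⇒ imp (Σ ⇒ Π) ∷ Θ) ∷ imp ([] ⇒ box (Σ ⇒ Π) ∷ []) ∷ Δ) G N
               → Provable (G [ N ])
replay-interbc G N Γ Δ Σ Π Λ Θ (cover ls (rbox m₂ (cover ls₂ (rmerge s₃ ∷ rs₂)) ∷ rs)) h =
  h N (cover ls (rbox m₂ (cover ls₂ (rmerge s₃ ∷ rs₂)) ∷ rmerge (cover [] (rbox m₂ s₃ ∷ [])) ∷ rs)) ⊑-refl
replay-interbc G (Γn ⇒ Δn) Γ Δ Σ Π Λ Θ
  (cover ls (rbox {U = Λ₁ ⇒ Θ₁} m₂ (cover ls₂ (rimp {U = Σ₁ ⇒ Π₁} m₃ s₃ ∷ rs₂)) ∷ rs)) h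
  with ∈⇒↭-front m₂ | ∈⇒↭-front m₃
... | Δr , p | Θr , p′ =
  let e = seq≈ {Γn} ↭-refl (trans≈ (↭⇒≈L p) (cons≈ (box≈ (≈-suc p′)) (≈L-refl Δr)))
      P = ⊑-trans (≈⇒⊑ e) (⊆⇒⊑ id λ { (here refl) → here refl ; (there m) → there (there m) })
      y = cover (All.map (mapˡ P) ls)
                (mapʳ P (rbox m₂ (cover ls₂ (rimp m₃ s₃ ∷ rs₂)))
                 ∷ rimp (there (here refl)) (cover [] (rbox (here refl) s₃ ∷ [])) ∷ All.map (mapʳ P) rs)
  in perm (fill-≈ G e) (interbc G Γn Δr Σ₁ Π₁ Λ₁ Θr (h _ y P))

replay-in-context : ∀ G {X T} → (G [ X ]) ≼ T
  → (∀ G′ N → X ≼ N → (∀ {Y} → (∀ T′ → (G [ Y ]) ≼ T′ → Provable T′) → Premise Y G′ N)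
      → Provable (G′ [ N ]))
  → Provable T
replay-in-context G {X} {T} s k =
  perm (split R) (k (ctx R) (focus R) (covers R) (λ ih N′ y P → ih _ (refill R _ N′ y P)))
  where R = locate G X T s

provable-≼ : ∀ {S} → Provable S → ∀ T → S ≼ T → Provable T
provable-≼ (perm e p) T s = provable-≼ p T (≼-respˡ-≈ e s)
provable-≼ (ax⊥ G Γ Δ) T s = replay-in-context G s λ G′ N x _ → replay-ax⊥ G′ N Γ Δ x
provable-≼ (ax⊤ G Γ Δ) T s = replay-in-context G s λ G′ N x _ → replay-ax⊤ G′ N Γ Δ x
provable-≼ (axp G Γ Δ q) T s = replay-in-context G s λ G′ N x _ → replay-axp G′ N Γ Δ q x
provable-≼ (∧L G Γ Δ A B p) T s = replay-in-context G s λ G′ N x ih →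
  replay-∧L G′ N Γ Δ A B x (ih (provable-≼ p))
provable-≼ (∧R G Γ Δ A B p q) T s = replay-in-context G s λ G′ N x ih →
  replay-∧R G′ N Γ Δ A B x (ih (provable-≼ p)) (ih (provable-≼ q))
provable-≼ (∨L G Γ Δ A B p q) T s = replay-in-context G s λ G′ N x ih →
  replay-∨L G′ N Γ Δ A B x (ih (provable-≼ p)) (ih (provable-≼ q))
provable-≼ (∨R G Γ Δ A B p) T s = replay-in-context G s λ G′ N x ih →
  replay-∨R G′ N Γ Δ A B x (ih (provable-≼ p))
provable-≼ (⊃L G Γ Δ A B p q) T s = replay-in-context G s λ G′ N x ih →
  replay-⊃L G′ N Γ Δ A B x (ih (provable-≼ p)) (ih (provable-≼ q))
provable-≼ (⊃R G Γ Δ A B p) T s = replay-in-context G s λ G′ N x ih →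
  replay-⊃R G′ N Γ Δ A B x (ih (provable-≼ p))
provable-≼ (□L G Γ Δ A Σ Π p) T s = replay-in-context G s λ G′ N x ih →
  replay-□L G′ N Γ Δ A Σ Π x (ih (provable-≼ p))
provable-≼ (□R G Γ Δ A p) T s = replay-in-context G s λ G′ N x ih →
  replay-□R G′ N Γ Δ A x (ih (provable-≼ p))
provable-≼ (◇L G Γ Δ A p) T s = replay-in-context G s λ G′ N x ih →
  replay-◇L G′ N Γ Δ A x (ih (provable-≼ p))
provable-≼ (◇R G Γ Δ A Σ Π p) T s = replay-in-context G s λ G′ N x ih →
  replay-◇R G′ N Γ Δ A Σ Π x (ih (provable-≼ p))
provable-≼ (trans G Γ Γ′ Δ Σ Π p) T s = replay-in-context G s λ G′ N x ih →
  replay-trans G′ N Γ Γ′ Δ Σ Π x (ih (provable-≼ p))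
provable-≼ (interfc G Γ Δ Σ Π Λ Θ p) T s = replay-in-context G s λ G′ N x ih →
  replay-interfc G′ N Γ Δ Σ Π Λ Θ x (ih (provable-≼ p))
provable-≼ (interbc G Γ Δ Σ Π Λ Θ p) T s = replay-in-context G s λ G′ N x ih →
  replay-interbc G′ N Γ Δ Σ Π Λ Θ x (ih (provable-≼ p))

-- Weakening into a context

_∘ᶜ_ : Ctx → Ctx → Ctx
hole         ∘ᶜ H = H
impC Γ Δ G   ∘ᶜ H = impC Γ Δ (G ∘ᶜ H)
boxC Γ Δ G   ∘ᶜ H = boxC Γ Δ (G ∘ᶜ H)

fill-∘ᶜ : ∀ G H X → (G ∘ᶜ H) [ X ] ≡ G [ H [ X ] ]
fill-∘ᶜ hole         H X = refl
fill-∘ᶜ (impC Γ Δ G) H X = cong (λ U → Γ ⇒ Δ ++ imp U ∷ []) (fill-∘ᶜ G H X)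
fill-∘ᶜ (boxC Γ Δ G) H X = cong (λ U → Γ ⇒ Δ ++ box U ∷ []) (fill-∘ᶜ G H X)

unnest : ∀ G H {X} → Provable ((G ∘ᶜ H) [ X ]) → Provable (G [ H [ X ] ])
unnest G H {X} = subst Provable (fill-∘ᶜ G H X)

nest : ∀ G H {X} → Provable (G [ H [ X ] ]) → Provable ((G ∘ᶜ H) [ X ])
nest G H {X} = subst Provable (sym (fill-∘ᶜ G H X))

provable-fill : ∀ G {S} → Provable S → Provable (G [ S ])
provable-fill G (perm e p) = perm (fill-≈ G e) (provable-fill G p)
provable-fill G (ax⊥ H Γ Δ)   = unnest G H (ax⊥ (G ∘ᶜ H) Γ Δ)
provable-fill G (ax⊤ H Γ Δ)   = unnest G H (ax⊤ (G ∘ᶜ H) Γ Δ)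
provable-fill G (axp H Γ Δ q) = unnest G H (axp (G ∘ᶜ H) Γ Δ q)
provable-fill G (∧L H Γ Δ A B p) = unnest G H (∧L (G ∘ᶜ H) Γ Δ A B (nest G H (provable-fill G p)))
provable-fill G (∧R H Γ Δ A B p q) = unnest G H (∧R (G ∘ᶜ H) Γ Δ A B (nest G H (provable-fill G p)) (nest G H (provable-fill G q)))
provable-fill G (∨L H Γ Δ A B p q) = unnest G H (∨L (G ∘ᶜ H) Γ Δ A B (nest G H (provable-fill G p)) (nest G H (provable-fill G q)))
provable-fill G (∨R H Γ Δ A B p) = unnest G H (∨R (G ∘ᶜ H) Γ Δ A B (nest G H (provable-fill G p)))
provable-fill G (⊃L H Γ Δ A B p q) = unnest G H (⊃L (G ∘ᶜ H) Γ Δ A B (nest G H (provable-fill G p)) (nest G H (provable-fill G q)))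
provable-fill G (⊃R H Γ Δ A B p) = unnest G H (⊃R (G ∘ᶜ H) Γ Δ A B (nest G H (provable-fill G p)))
provable-fill G (□L H Γ Δ A Σ Π p) = unnest G H (□L (G ∘ᶜ H) Γ Δ A Σ Π (nest G H (provable-fill G p)))
provable-fill G (□R H Γ Δ A p) = unnest G H (□R (G ∘ᶜ H) Γ Δ A (nest G H (provable-fill G p)))
provable-fill G (◇L H Γ Δ A p) = unnest G H (◇L (G ∘ᶜ H) Γ Δ A (nest G H (provable-fill G p)))
provable-fill G (◇R H Γ Δ A Σ Π p) = unnest G H (◇R (G ∘ᶜ H) Γ Δ A Σ Π (nest G H (provable-fill G p)))
provable-fill G (trans H Γ Γ′ Δ Σ Π p) = unnest G H (trans (G ∘ᶜ H) Γ Γ′ Δ Σ Π (nest G H (provable-fill G p)))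
provable-fill G (interfc H Γ Δ Σ Π Λ Θ p) = unnest G H (interfc (G ∘ᶜ H) Γ Δ Σ Π Λ Θ (nest G H (provable-fill G p)))
provable-fill G (interbc H Γ Δ Σ Π Λ Θ p) = unnest G H (interbc (G ∘ᶜ H) Γ Δ Σ Π Λ Θ (nest G H (provable-fill G p)))

≼⇒admissible : ∀ G {S S′} → S ≼ S′ → Provable (G [ S ]) → Provable (G [ S′ ])
≼⇒admissible G s p = provable-≼ p _ (≼-fill G s)

∈-++-dedup : ∀ {A : Set} {x : A} L y → x ∈ L ++ y ∷ y ∷ [] → x ∈ L ++ y ∷ []
∈-++-dedup L y m with ∈-++⁻ L m
... | inj₁ m′                 = ∈-++⁺ˡ m′
... | inj₂ (here e)           = ∈-++⁺ʳ L (here e)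
... | inj₂ (there (here e))   = ∈-++⁺ʳ L (here e)

proposition1 : Admissible-wR × Admissible-wL × Admissible-wC × Admissible-cR × Admissible-cL × Admissible-∅
proposition1 = wR , wL , (λ G Γ Δ → provable-fill G) , cR , cL , drop-∅
  where
  wR : Admissible-wR
  wR G Γ Δ O = ≼⇒admissible G (⊆⇒≼ (Γ ⇒ Δ) id ∈-++⁺ˡ)

  wL : Admissible-wL
  wL G Γ Δ A = ≼⇒admissible G (⊆⇒≼ (Γ ⇒ Δ) there id)

  cR : Admissible-cR
  cR G Γ Δ O = ≼⇒admissible G (⊆⇒≼ (Γ ⇒ Δ ++ O ∷ O ∷ []) id (∈-++-dedup Δ O))

  cL : Admissible-cL
  cL G Γ Δ A = ≼⇒admissible G (⊆⇒≼ (Γ ++ A ∷ A ∷ [] ⇒ Δ) (∈-++-dedup Γ A) id)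

  drop-∅ : Admissible-∅
  drop-∅ G Γ Δ = ≼⇒admissible G (cover (⊆⇒lcovs Γ id) (++⁺ (⊆⇒rcovs Δ id) (rmerge (cover [] []) ∷ [])))
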